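{- Fix real numbers $\alpha,\beta$ with $1/2<\alpha<\beta<1$ and put $\gamma=3/2-\alpha$. Let $k,m,n$ be positive integers with $k$ sufficiently large, $m\leqslant n$, $n^\alpha\leqslant k\leqslant m^\beta$, and $t(m+j)=t(n+j)$ for all $0\leqslant j\leqslant k$. Then $n=m+O(m^\gamma)$.
   Context: For $n\ge1$, $t(n)$ is the rooted planar tree of $n$: $t(1)$ is the single-vertex tree; if $n=p_1^{a_1}\cdots p_s^{a_s}$ with primes $p_1<\dots<p_s$ and $a_i\ge1$, then $t(n)$ is a root with $s$ edges ordered left to right, the $i$-th edge leading to a copy of $t(a_i)$. The implied constant in $O(\cdot)$ may depend on $\alpha,\beta$. -}

module Defs where

open import Data.Nat as ℕ using (ℕ; zero; suc; _+_; _*_; _∸_; _^_; _≤_; _<_)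
open import Data.Nat.Divisibility using (_∣?_; divides)
open import Data.Nat.Primality using (prime?)
open import Data.Integer as ℤ using (+_; ∣_∣)
open import Data.Rational as ℚ using (ℚ; ↥_; ↧ₙ_)
open import Data.List using (List; []; _∷_; map; upTo; filter)
open import Data.Product using (Σ; _×_)
open import Data.Sum using (_⊎_)
open import Relation.Nullary using (yes; no; ¬_)

-- p-adic valuation of n, computed with fuel (fuel n always suffices for
-- a prime p, since each step at least halves n).
valF : ℕ → ℕ → ℕ → ℕ
valF zero    p n       = 0
valF (suc f) p zero    = 0
valF (suc f) p (suc n) with p ∣? suc n
... | yes (divides q _) = suc (valF f p q)
... | no _              = 0

val : ℕ → ℕ → ℕ
val p n = valF n p n

primeDivisors : ℕ → List ℕ
primeDivisors n = filter (λ p → p ∣? n) (filter prime? (upTo (suc n)))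

exponents : ℕ → List ℕ
exponents n = map (λ p → val p n) (primeDivisors n)

-- rooted planar trees: a root with an ordered list of subtrees
data Tree : Set where
  node : List Tree → Tree

-- t with fuel; fuel n suffices since every exponent a_i of n satisfies a_i < n
tF : ℕ → ℕ → Tree
tF zero    n = node []
tF (suc f) n = node (map (tF f) (exponents n))

t : ℕ → Tree
t n = tF n n

-- Real numbers as Dedekind cuts (L = rationals below, U = rationals above)

record ℝ : Set₁ where
  field
    L : ℚ → Set
    U : ℚ → Set
    L-inhabited : Σ ℚ L
    U-inhabited : Σ ℚ U
    L-rounded₁ : ∀ q → L q → Σ ℚ (λ r → q ℚ.< r × L r)
    L-rounded₂ : ∀ q r → q ℚ.< r → L r → L q
    U-rounded₁ : ∀ q → U q → Σ ℚ (λ r → r ℚ.< q × U r)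
    U-rounded₂ : ∀ q r → q ℚ.< r → U q → U r
    disjoint : ∀ q → ¬ (L q × U q)
    located : ∀ q r → q ℚ.< r → L q ⊎ U r

open ℝ public

_<ℝ_ : ℝ → ℝ → Set
x <ℝ y = Σ ℚ (λ q → U x q × L y q)

-- Comparisons with rational powers, for rationals r = p/d with p ≥ 0

_^[_]≤_ : ℕ → ℚ → ℕ → Set
a ^[ r ]≤ b = a ^ ∣ ↥ r ∣ ≤ b ^ (↧ₙ r)

_≤_^[_] : ℕ → ℕ → ℚ → Set
b ≤ a ^[ r ] = b ^ (↧ₙ r) ≤ a ^ ∣ ↥ r ∣

_≤_·_^[_] : ℕ → ℕ → ℕ → ℚ → Set
b ≤ C · a ^[ r ] = b ^ (↧ₙ r) ≤ C ^ (↧ₙ r) * a ^ ∣ ↥ r ∣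

{-# OPTIONS --safe #-}
-- The hypotheses force n = m, so the bound holds with C = 0. For x ≥ 1 the root of t(x) has a
-- non-leaf child iff p² ∣ x for some prime p, so t(m + j) = t(n + j) transfers this property from
-- m + j to n + j. If d = n - m > 0, counting the j ≤ k with q² ∣ m + j shows q² ∣ d for every prime
-- q ≤ Q ≈ (k / √n)^(1/2). Hence π(Q)! ≤ ∏_{q ≤ Q} q ≤ d ≤ n, while k ≥ n^r with r > 1/2 gives
-- n ≤ Q^O(1), and Erdős' bound Q ≤ 4^π(Q) makes π(Q)! outgrow every power of Q.
module Submission where

-- A separate module, since the statement needs Data.Rational's _/_ where the proof uses Data.Nat's.
module ShiftRigidity where

  open import Defs
  open import Data.Nat
  open import Data.Nat.Properties
  open import Data.Nat.Divisibility
  open import Data.Nat.DivMod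
  open import Data.Nat.Primality
  open import Data.Nat.Coprimality as Cop using (Coprime; coprime-divisor)
  open import Data.Nat.Primality.Factorisation using (factorise; factorisationHasAllPrimeFactors)
  open import Data.Nat.ListAction using (product)
  open import Data.List using (List; []; _∷_; _++_; map; filter; length; upTo; downFrom; cartesianProductWith)
  open import Data.List.Membership.Propositional using (_∈_; lose; find)
  open import Data.List.Membership.Propositional.Properties
  open import Data.List.Relation.Unary.Any as Any using (Any; here; there)
  open import Data.List.Relation.Unary.Any.Properties as Anyₚ using ()
  open import Data.List.Relation.Unary.All using (All; []; _∷_)
  open import Data.List.Relation.Unary.All.Properties using (all-filter)
  open import Data.List.Properties using (filter-notAll; length-++; length-map; length-upTo)
  open import Data.Product using (Σ; _×_; _,_; proj₁; proj₂)
  open import Data.Sum using (inj₁; inj₂; [_,_]′)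
  open import Data.Empty using (⊥-elim)
  open import Relation.Nullary using (¬_; Dec; yes; no)
  open import Relation.Nullary.Decidable using (_×-dec_; ¬?)
  open import Function using (_∘_)
  open import Induction.WellFounded using (Acc; acc)
  open import Data.Nat.Induction using (<-wellFounded)
  open import Data.Nat.Tactic.RingSolver using (solve-∀)
  open import Algebra.Properties.CommutativeSemigroup +-commutativeSemigroup
    using () renaming (interchange to +-interchange; xy∙z≈xz∙y to +-right-comm)
  open import Algebra.Properties.CommutativeSemigroup *-commutativeSemigroup
    using () renaming (interchange to *-interchange)
  open import Relation.Unary using (Decidable)
  open import Relation.Binary.PropositionalEquality

  prime>1 : ∀ {p} → Prime p → 1 < p
  prime>1 {p} pp = nonTrivial⇒n>1 p {{prime⇒nonTrivial pp}}

  ∃prime∣ : ∀ {a} → 1 < a → Σ ℕ λ p → Prime p × p ∣ a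
  ∃prime∣ {a@(suc (suc _))} _ with factorise a
  ... | record { factors = p ∷ ps ; isFactorisation = eq ; factorsPrime = pp ∷ _ } =
    p , pp , divides (product ps) (trans eq (*-comm p (product ps)))
  ... | record { factors = [] ; isFactorisation = () }
  ∃prime∣ {1} (s≤s ())

  m+n≢0 : ∀ m n .{{_ : NonZero m}} → NonZero (m + n)
  m+n≢0 (suc m) n = _

  n≤n*n : ∀ n → n ≤ n * n
  n≤n*n zero    = z≤n
  n≤n*n (suc n) = m≤m*n (suc n) (suc n)

  m*m<n*n⇒m<n : ∀ {m n} → m * m < n * n → m < n
  m*m<n*n⇒m<n m²<n² = ≰⇒> λ n≤m → <⇒≱ m²<n² (*-mono-≤ n≤m n≤m)

  ^-distribʳ-* : ∀ m n o → (m * n) ^ o ≡ m ^ o * n ^ o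
  ^-distribʳ-* m n zero    = refl
  ^-distribʳ-* m n (suc o) = trans (cong (m * n *_) (^-distribʳ-* m n o)) (*-interchange m n (m ^ o) (n ^ o))

  ^-swap : ∀ c g s b → (c * g ^ s) ^ b ≡ c ^ b * (g ^ b) ^ s
  ^-swap c g s b = begin
    (c * g ^ s) ^ b      ≡⟨ ^-distribʳ-* c (g ^ s) b ⟩
    c ^ b * (g ^ s) ^ b  ≡⟨ cong (c ^ b *_) (^-*-assoc g s b) ⟩
    c ^ b * g ^ (s * b)  ≡⟨ cong (λ e → c ^ b * g ^ e) (*-comm s b) ⟩
    c ^ b * g ^ (b * s)  ≡⟨ cong (c ^ b *_) (^-*-assoc g b s) ⟨
    c ^ b * (g ^ b) ^ s  ∎
    where open ≡-Reasoning

  m*n≤o⇒m≤o/n : ∀ m n o .{{_ : NonZero n}} → m * n ≤ o → m ≤ o / n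
  m*n≤o⇒m≤o/n m n o m*n≤o = subst (_≤ o / n) (m*n/n≡m m n) (/-monoˡ-≤ n m*n≤o)

  sqrt-bracket : ∀ c .{{_ : NonZero c}} X → Σ ℕ λ R → R * R * c ≤ X × X < suc R * suc R * c
  sqrt-bracket c zero    = 0 , z≤n , subst (0 <_) (sym (+-identityʳ c)) (>-nonZero⁻¹ c)
  sqrt-bracket c (suc X) with R , R²c≤X , X<[R+1]²c ← sqrt-bracket c X
    with suc R * suc R * c ≤? suc X
  ... | yes [R+1]²c≤X+1 = suc R , [R+1]²c≤X+1 ,
    ≤-<-trans X<[R+1]²c (*-monoˡ-< c (*-mono-< (n<1+n (suc R)) (n<1+n (suc R))))
  ... | no  [R+1]²c≰X+1 = R , m≤n⇒m≤1+n R²c≤X , ≰⇒> [R+1]²c≰X+1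

  n<m^n : ∀ {m} → 1 < m → ∀ n → n < m ^ n
  n<m^n 1<m zero    = z<s
  n<m^n {m} 1<m (suc n) = begin-strict
    suc n              <⟨ s≤s (n<m^n 1<m n) ⟩
    1 + m ^ n          ≤⟨ +-monoˡ-≤ (m ^ n) (m^n>0 m {{>-nonZero (<-trans z<s 1<m)}} n) ⟩
    m ^ n + m ^ n      ≡⟨ cong (m ^ n +_) (+-identityʳ (m ^ n)) ⟨
    2 * m ^ n          ≤⟨ *-monoˡ-≤ (m ^ n) 1<m ⟩
    m * m ^ n          ∎
    where open ≤-Reasoning

  ^≤! : ∀ c s → c ^ s ≤ (c + s) !
  ^≤! c zero    = 1≤n! (c + 0)
  ^≤! c (suc s) = begin
    c * c ^ s              ≤⟨ *-mono-≤ (m≤n⇒m≤1+n (m≤m+n c s)) (^≤! c s) ⟩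
    suc (c + s) * (c + s) ! ≡⟨ cong _! (+-suc c s) ⟨
    (c + suc s) !          ∎
    where open ≤-Reasoning

  -- with c = G²: (c + t)! ≥ G^t · G^t, and G^t > t ≥ C · G^c
  exp<!-eventually : ∀ C G → 1 < G → Σ ℕ λ S → ∀ s → S ≤ s → C * G ^ s < s !
  exp<!-eventually C G 1<G = c + C * G ^ c , eventually
    where
    c = G * G
    instance
      G≢0 : NonZero G
      G≢0 = >-nonZero (<-trans z<s 1<G)
    eventually : ∀ s → c + C * G ^ c ≤ s → C * G ^ s < s !
    eventually s S≤s with t , refl ← m≤n⇒∃[o]m+o≡n (≤-trans (m≤m+n c (C * G ^ c)) S≤s) = begin-strict
      C * G ^ (c + t)       ≡⟨ cong (C *_) (^-distribˡ-+-* G c t) ⟩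
      C * (G ^ c * G ^ t)   ≡⟨ *-assoc C (G ^ c) (G ^ t) ⟨
      C * G ^ c * G ^ t     <⟨ *-monoˡ-< (G ^ t) {{m^n≢0 G t}} (≤-<-trans (+-cancelˡ-≤ c _ _ S≤s) (n<m^n 1<G t)) ⟩
      G ^ t * G ^ t         ≡⟨ ^-distribʳ-* G G t ⟨
      c ^ t                 ≤⟨ ^≤! c t ⟩
      (c + t) !             ∎
      where open ≤-Reasoning

  prime∤⇒coprime : ∀ {p n} → Prime p → ¬ p ∣ n → Coprime p n
  prime∤⇒coprime pp p∤n {i} (i∣p , i∣n) with prime⇒irreducible pp i∣p
  ... | inj₁ i≡1 = i≡1
  ... | inj₂ refl = ⊥-elim (p∤n i∣n)

  primes-≢⇒coprime : ∀ {p q} → Prime p → Prime q → p ≢ q → Coprime p q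
  primes-≢⇒coprime pp pq p≢q = prime∤⇒coprime pp λ p∣q →
    [ (λ { refl → ¬prime[1] pp }) , p≢q ]′ (prime⇒irreducible pq p∣q)

  coprime-*ʳ : ∀ {a b c} → Coprime a b → Coprime a c → Coprime a (b * c)
  coprime-*ʳ {a} {b} cab cac {i} (i∣a , i∣bc) = cac (i∣a , coprime-divisor cib i∣bc)
    where
    cib : Coprime i b
    cib (e∣i , e∣b) = cab (∣-trans e∣i i∣a , e∣b)

  coprime-*ˡ : ∀ {a b c} → Coprime a c → Coprime b c → Coprime (a * b) c
  coprime-*ˡ cac cbc = Cop.sym (coprime-*ʳ (Cop.sym cac) (Cop.sym cbc))

  coprime⇒*∣ : ∀ {m n o} → Coprime m n → m ∣ o → n ∣ o → m * n ∣ o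
  coprime⇒*∣ {m} {n} c m∣o (divides w refl) =
    *-monoˡ-∣ n (coprime-divisor c (subst (m ∣_) (*-comm w n) m∣o))

  ∣-shift : ∀ {M x j j′} → j ≤ j′ → M ∣ x + j → M ∣ x + j′ → M ∣ j′ ∸ j
  ∣-shift {M} {x} {j} {j′} j≤j′ M∣x+j M∣x+j′ = ∣m+n∣m⇒∣n (subst (M ∣_) x+j′≡ M∣x+j′) M∣x+j
    where
    x+j′≡ : x + j′ ≡ x + j + (j′ ∸ j)
    x+j′≡ = trans (cong (x +_) (sym (m+[n∸m]≡n j≤j′))) (sym (+-assoc x j (j′ ∸ j)))

  -- Squareful numbers and the tree t

  Squareful : ℕ → Set
  Squareful x = Σ ℕ λ p → Prime p × p * p ∣ x

  ∈-primeDivisors⁺ : ∀ {p x} → .{{NonZero x}} → Prime p → p ∣ x → p ∈ primeDivisors x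
  ∈-primeDivisors⁺ {p} {x} pp p∣x =
    ∈-filter⁺ (_∣? x) (∈-filter⁺ prime? {xs = upTo (suc x)} (∈-upTo⁺ (s≤s (∣⇒≤ p∣x))) pp) p∣x

  ∈-primeDivisors⁻ : ∀ {p x} → p ∈ primeDivisors x → Prime p
  ∈-primeDivisors⁻ {x = x} p∈ = proj₂ (∈-filter⁻ prime? {xs = upTo (suc x)} (proj₁ (∈-filter⁻ (_∣? x) p∈)))

  valF≥1⇒∣ : ∀ f p x → 1 ≤ valF f p x → p ∣ x
  valF≥1⇒∣ (suc f) p (suc x) h with p ∣? suc x
  ... | yes p∣x = p∣x

  valF≥2⇒∣ : ∀ f p x → 2 ≤ valF f p x → p * p ∣ x
  valF≥2⇒∣ (suc f) p (suc x) h with p ∣? suc x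
  ... | yes (divides q eq) with divides r refl ← valF≥1⇒∣ f p q (≤-pred h) =
    divides r (trans eq (*-assoc r p p))

  ∣⇒valF≥1 : ∀ f p x → 1 ≤ f → .{{NonZero x}} → p ∣ x → 1 ≤ valF f p x
  ∣⇒valF≥1 (suc f) p (suc x) _ p∣x with p ∣? suc x
  ... | yes _ = s≤s z≤n
  ... | no p∤x = ⊥-elim (p∤x p∣x)

  ∣⇒valF≥2 : ∀ f p x → 2 ≤ f → .{{NonZero p}} → .{{NonZero x}} → p * p ∣ x → 2 ≤ valF f p x
  ∣⇒valF≥2 (suc f) p (suc x) f≥2 pp∣x with p ∣? suc x
  ... | no p∤x = ⊥-elim (p∤x (∣-trans (m∣m*n p) pp∣x))
  ... | yes (divides (suc q) eq) =
    s≤s (∣⇒valF≥1 f p (suc q) (≤-pred f≥2) (*-cancelʳ-∣ p (subst (p * p ∣_) eq pp∣x)))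
  ... | yes (divides zero eq) with () ← eq

  leaf : Tree
  leaf = node []

  HasInnerChild : Tree → Set
  HasInnerChild (node cs) = Any (_≢ leaf) cs

  tF-leaf : ∀ f a → a ≤ 1 → tF f a ≡ leaf
  tF-leaf zero          a       _ = refl
  tF-leaf (suc f) zero          _ = refl
  tF-leaf (suc f) (suc zero)    _ = refl
  tF-leaf (suc f) (suc (suc a)) (s≤s ())

  tF-inner : ∀ f a → 1 < a → tF (suc f) a ≢ leaf
  tF-inner f a a>1 with p , pp , p∣a ← ∃prime∣ a>1 =
    node≢leaf (∈-map⁺ (tF f) (∈-map⁺ (λ p → val p a) (∈-primeDivisors⁺ {{>-nonZero (<-trans z<s a>1)}} pp p∣a)))
    where
    node≢leaf : ∀ {c cs} → c ∈ cs → node cs ≢ leaf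
    node≢leaf c∈ refl with () ← c∈

  squareful⇒hasInnerChild : ∀ {x} → .{{NonZero x}} → Squareful x → HasInnerChild (t x)
  squareful⇒hasInnerChild {1} (p , pp , pp∣1)
    with s≤s () ← ≤-trans (*-mono-≤ (prime>1 pp) (prime>1 pp)) (∣⇒≤ pp∣1)
  squareful⇒hasInnerChild {x@(suc (suc f))} (p , pp , pp∣x) =
    Anyₚ.map⁺ (Anyₚ.map⁺ (lose (∈-primeDivisors⁺ pp (∣-trans (m∣m*n p) pp∣x))
      (tF-inner f _ (∣⇒valF≥2 x p x (s≤s (s≤s z≤n)) {{prime⇒nonZero pp}} pp∣x))))

  hasInnerChild⇒squareful : ∀ x → HasInnerChild (t x) → Squareful x
  hasInnerChild⇒squareful (suc f) inner
    with p , p∈ , ≢leaf ← find (Anyₚ.map⁻ (Anyₚ.map⁻ inner))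
    with 2 ≤? val p (suc f)
  ... | yes v≥2 = p , ∈-primeDivisors⁻ {x = suc f} p∈ , valF≥2⇒∣ (suc f) p (suc f) v≥2
  ... | no  v≱2 = ⊥-elim (≢leaf (tF-leaf f _ (≤-pred (≰⇒> v≱2))))

  squareful-resp-t : ∀ {x y} → .{{NonZero x}} → t x ≡ t y → Squareful x → Squareful y
  squareful-resp-t {y = y} eq sq =
    hasInnerChild⇒squareful y (subst HasInnerChild eq (squareful⇒hasInnerChild sq))

  -- Counting in windows

  indicator : ∀ {A : Set} → Dec A → ℕ
  indicator (yes _) = 1
  indicator (no _)  = 0

  count : ∀ {P : ℕ → Set} → Decidable P → ℕ → ℕ → ℕ
  count P? a zero    = 0
  count P? a (suc ℓ) = indicator (P? a) + count P? (suc a) ℓ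

  module _ {P : ℕ → Set} (P? : Decidable P) where

    count-++ : ∀ a ℓ₁ ℓ₂ → count P? a (ℓ₁ + ℓ₂) ≡ count P? a ℓ₁ + count P? (a + ℓ₁) ℓ₂
    count-++ a zero      ℓ₂ = cong (λ b → count P? b ℓ₂) (sym (+-identityʳ a))
    count-++ a (suc ℓ₁) ℓ₂ = begin
      indicator (P? a) + count P? (suc a) (ℓ₁ + ℓ₂)
        ≡⟨ cong (indicator (P? a) +_) (count-++ (suc a) ℓ₁ ℓ₂) ⟩
      indicator (P? a) + (count P? (suc a) ℓ₁ + count P? (suc a + ℓ₁) ℓ₂)
        ≡⟨ sym (+-assoc (indicator (P? a)) _ _) ⟩
      count P? a (suc ℓ₁) + count P? (suc a + ℓ₁) ℓ₂
        ≡⟨ cong (λ b → count P? a (suc ℓ₁) + count P? b ℓ₂) (sym (+-suc a ℓ₁)) ⟩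
      count P? a (suc ℓ₁) + count P? (a + suc ℓ₁) ℓ₂ ∎
      where open ≡-Reasoning

    count-monoʳ-≤ : ∀ a {ℓ₁ ℓ₂} → ℓ₁ ≤ ℓ₂ → count P? a ℓ₁ ≤ count P? a ℓ₂
    count-monoʳ-≤ a {ℓ₁} {ℓ₂} ℓ₁≤ℓ₂ = begin
      count P? a ℓ₁                                   ≤⟨ m≤m+n _ _ ⟩
      count P? a ℓ₁ + count P? (a + ℓ₁) (ℓ₂ ∸ ℓ₁)     ≡⟨ count-++ a ℓ₁ (ℓ₂ ∸ ℓ₁) ⟨
      count P? a (ℓ₁ + (ℓ₂ ∸ ℓ₁))                     ≡⟨ cong (count P? a) (m+[n∸m]≡n ℓ₁≤ℓ₂) ⟩
      count P? a ℓ₂                                   ∎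
      where open ≤-Reasoning

    count>0 : ∀ a ℓ {j} → a ≤ j → j < a + ℓ → P j → 0 < count P? a ℓ
    count>0 a zero {j} a≤j j<a+0 _ = ⊥-elim (<⇒≱ (subst (j <_) (+-identityʳ a) j<a+0) a≤j)
    count>0 a (suc ℓ) {j} a≤j j<a+ℓ pj with P? a | m≤n⇒m<n∨m≡n a≤j
    ... | yes _ | _         = s≤s z≤n
    ... | no ¬pa | inj₂ refl = ⊥-elim (¬pa pj)
    ... | no _   | inj₁ a<j  = count>0 (suc a) ℓ a<j (subst (j <_) (+-suc a ℓ) j<a+ℓ) pj

    count≡0 : ∀ a ℓ → (∀ {j} → a ≤ j → j < a + ℓ → ¬ P j) → count P? a ℓ ≡ 0
    count≡0 a zero    _    = refl
    count≡0 a (suc ℓ) none with P? a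
    ... | yes pa = ⊥-elim (none ≤-refl (m<m+n a z<s) pa)
    ... | no _   = count≡0 (suc a) ℓ λ {j} a<j j< → none (<⇒≤ a<j) (subst (j <_) (sym (+-suc a ℓ)) j<)

    module _ (N : ℕ) (sparse : ∀ {i j} → P i → P j → i < j → i + N ≤ j) where

      count-window : ∀ a ℓ → ℓ ≤ N → count P? a ℓ ≤ 1
      count-window a zero    _   = z≤n
      count-window a (suc ℓ) ℓ<N with P? a
      ... | no _   = count-window (suc a) ℓ (<⇒≤ ℓ<N)
      ... | yes pa = ≤-reflexive (cong suc (count≡0 (suc a) ℓ λ a<j j< pj →
        <⇒≱ (+-monoʳ-< a ℓ<N) (≤-trans (sparse pa pj a<j) (≤-pred j<))))

      count-blocks : ∀ a Y → count P? a (Y * N) ≤ Y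
      count-blocks a zero    = z≤n
      count-blocks a (suc Y) = begin
        count P? a (N + Y * N)                   ≡⟨ count-++ a N (Y * N) ⟩
        count P? a N + count P? (a + N) (Y * N)  ≤⟨ +-mono-≤ (count-window a N ≤-refl) (count-blocks (a + N) Y) ⟩
        suc Y                                    ∎
        where open ≤-Reasoning

      count-sparse : ∀ a ℓ .{{_ : NonZero N}} → count P? a ℓ ≤ ℓ / N + 1
      count-sparse a ℓ = begin
        count P? a ℓ
          ≡⟨ cong (count P? a) (trans (m≡m%n+[m/n]*n ℓ N) (+-comm (ℓ % N) _)) ⟩
        count P? a (ℓ / N * N + ℓ % N)
          ≡⟨ count-++ a (ℓ / N * N) (ℓ % N) ⟩
        count P? a (ℓ / N * N) + count P? (a + ℓ / N * N) (ℓ % N)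
          ≤⟨ +-mono-≤ (count-blocks a (ℓ / N)) (count-window _ (ℓ % N) (<⇒≤ (m%n<n ℓ N))) ⟩
        ℓ / N + 1 ∎
        where open ≤-Reasoning

  ∃multiple : ∀ M → .{{NonZero M}} → ∀ z → Σ ℕ λ i → i < M × M ∣ z + i
  ∃multiple M@(suc M′) zero    = 0 , z<s , divides 0 refl
  ∃multiple M@(suc M′) (suc z) with ∃multiple M z
  ... | suc i , i<M , M∣z+i = i , <⇒≤ i<M , subst (M ∣_) (+-suc z i) M∣z+i
  ... | zero  , _   , M∣z+0 = M′ , ≤-refl ,
    subst (M ∣_) (+-suc z M′)
      (∣m∣n⇒∣m+n (subst (M ∣_) (+-identityʳ z) M∣z+0) ∣-refl)

  count-multiples : ∀ M → .{{NonZero M}} → ∀ x a Y → Y ≤ count (λ j → M ∣? x + j) a (Y * M)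
  count-multiples M x a zero    = z≤n
  count-multiples M x a (suc Y) with i , i<M , M∣x+a+i ← ∃multiple M (x + a) = begin
    suc Y                          ≤⟨ +-mono-≤ hit (count-multiples M x (a + M) Y) ⟩
    count M∣x+? a M + count M∣x+? (a + M) (Y * M)  ≡⟨ count-++ M∣x+? a M (Y * M) ⟨
    count M∣x+? a (M + Y * M) ∎
    where
    open ≤-Reasoning
    M∣x+? = λ j → M ∣? x + j
    hit : 1 ≤ count M∣x+? a M
    hit = count>0 M∣x+? a M (m≤m+n a i) (+-monoʳ-< a i<M) (subst (M ∣_) (+-assoc x a i) M∣x+a+i)

  sum< : ℕ → (ℕ → ℕ) → ℕ
  sum< zero    f = 0
  sum< (suc B) f = sum< B f + f B

  infix 5 sum<
  syntax sum< B (λ i → e) = ∑[ i < B ] e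

  sum<-+ : ∀ B f g → ∑[ i < B ] (f i + g i) ≡ sum< B f + sum< B g
  sum<-+ zero    f g = refl
  sum<-+ (suc B) f g =
    trans (cong (_+ (f B + g B)) (sum<-+ B f g)) (+-interchange (sum< B f) (sum< B g) (f B) (g B))

  sum<-const : ∀ B c → ∑[ i < B ] c ≡ B * c
  sum<-const zero    c = refl
  sum<-const (suc B) c = trans (cong (_+ c) (sum<-const B c)) (+-comm (B * c) c)

  sum<-mono-≤ : ∀ B {f g} → (∀ i → i < B → f i ≤ g i) → sum< B f ≤ sum< B g
  sum<-mono-≤ zero    f≤g = z≤n
  sum<-mono-≤ (suc B) f≤g = +-mono-≤ (sum<-mono-≤ B λ i i<B → f≤g i (m<n⇒m<1+n i<B)) (f≤g B ≤-refl)

  sum<-monoˡ-≤ : ∀ f {B B′} → B ≤ B′ → sum< B f ≤ sum< B′ f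
  sum<-monoˡ-≤ f {B} {B′} B≤B′ with m≤n⇒m<n∨m≡n B≤B′
  ... | inj₂ refl            = ≤-refl
  ... | inj₁ (s≤s B≤B′-1) = ≤-trans (sum<-monoˡ-≤ f B≤B′-1) (m≤m+n _ _)

  term≤sum< : ∀ f {i} B → i < B → f i ≤ sum< B f
  term≤sum< f {i} (suc B) i<1+B with m≤n⇒m<n∨m≡n (≤-pred i<1+B)
  ... | inj₂ refl = m≤n+m (f i) (sum< B f)
  ... | inj₁ i<B  = ≤-trans (term≤sum< f B i<B) (m≤m+n _ _)

  count-union : ∀ {P : ℕ → Set} {Q : ℕ → ℕ → Set} (P? : Decidable P) (Q? : ∀ i → Decidable (Q i)) →
    ∀ B a ℓ → (∀ {j} → a ≤ j → j < a + ℓ → P j → Σ ℕ λ i → i < B × Q i j) →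
    count P? a ℓ ≤ ∑[ i < B ] count (Q? i) a ℓ
  count-union P? Q? B a zero    _     = z≤n
  count-union {P} {Q} P? Q? B a (suc ℓ) cover = begin
    indicator (P? a) + count P? (suc a) ℓ
      ≤⟨ +-mono-≤ first (count-union P? Q? B (suc a) ℓ cover′) ⟩
    (∑[ i < B ] indicator (Q? i a)) + (∑[ i < B ] count (Q? i) (suc a) ℓ)
      ≡⟨ sum<-+ B (λ i → indicator (Q? i a)) (λ i → count (Q? i) (suc a) ℓ) ⟨
    ∑[ i < B ] count (Q? i) a (suc ℓ) ∎
    where
    open ≤-Reasoning
    cover′ : ∀ {j} → suc a ≤ j → j < suc a + ℓ → P j → Σ ℕ λ i → i < B × Q i j
    cover′ {j} a<j j< = cover (<⇒≤ a<j) (subst (j <_) (sym (+-suc a ℓ)) j<)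
    first : indicator (P? a) ≤ ∑[ i < B ] indicator (Q? i a)
    first with P? a
    ... | no _   = z≤n
    ... | yes pa with i , i<B , qia ← cover ≤-refl (m<m+n a z<s) pa
      with Q? i a | term≤sum< (λ i → indicator (Q? i a)) B i<B
    ...   | yes _  | le = le
    ...   | no ¬qa | _  = ⊥-elim (¬qa qia)

  infixl 7 _/²_

  _/²_ : ℕ → ℕ → ℕ
  Y /² 0 = 0
  Y /² 1 = 0
  Y /² i@(suc (suc _)) = Y / (i * i)

  -- the floor version of 1/(u+2) + 1/((u+2)(u+1)) = 1/(u+1)
  /-telescope-step : ∀ Y u → Y / suc (suc u) + Y / (suc (suc u) * suc u) ≤ Y / suc u
  /-telescope-step Y u = m*n≤o⇒m≤o/n (a + b) (suc u) Y (begin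
    (a + b) * suc u        ≡⟨ *-distribʳ-+ (suc u) a b ⟩
    a * suc u + b * suc u  ≤⟨ +-monoʳ-≤ (a * suc u) b*[u+1]≤a ⟩
    a * suc u + a          ≡⟨ trans (+-comm (a * suc u) a) (sym (*-suc a (suc u))) ⟩
    a * suc (suc u)        ≤⟨ m/n*n≤m Y (suc (suc u)) ⟩
    Y                      ∎)
    where
    open ≤-Reasoning
    a = Y / suc (suc u)
    b = Y / (suc (suc u) * suc u)
    b*[u+1]≤a : b * suc u ≤ a
    b*[u+1]≤a = subst (λ c → c * suc u ≤ a) (m/n/o≡m/[n*o] Y (suc (suc u)) (suc u)) (m/n*n≤m a (suc u))

  sum</²-telescope : ∀ Y U → (∑[ i < 3 + U ] Y /² i) + Y / (2 + U) ≤ Y / 4 + Y / 2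
  sum</²-telescope Y zero    = ≤-refl
  sum</²-telescope Y (suc U) = begin
    (∑[ i < 3 + U ] Y /² i) + Y /² (3 + U) + Y / (3 + U)   ≡⟨ +-assoc (∑[ i < 3 + U ] Y /² i) _ _ ⟩
    (∑[ i < 3 + U ] Y /² i) + (Y /² (3 + U) + Y / (3 + U)) ≤⟨ +-monoʳ-≤ (∑[ i < 3 + U ] Y /² i) step ⟩
    (∑[ i < 3 + U ] Y /² i) + Y / (2 + U)                  ≤⟨ sum</²-telescope Y U ⟩
    Y / 4 + Y / 2                                        ∎
    where
    open ≤-Reasoning
    step : Y /² (3 + U) + Y / (3 + U) ≤ Y / (2 + U)
    step = begin
      Y / ((3 + U) * (3 + U)) + Y / (3 + U) ≤⟨ +-monoˡ-≤ _ (/-monoʳ-≤ Y (*-monoʳ-≤ (3 + U) (n≤1+n (2 + U)))) ⟩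
      Y / ((3 + U) * (2 + U)) + Y / (3 + U) ≡⟨ +-comm (Y / ((3 + U) * (2 + U))) _ ⟩
      Y / (3 + U) + Y / ((3 + U) * (2 + U)) ≤⟨ /-telescope-step Y (suc U) ⟩
      Y / (2 + U)                           ∎

  sum</² : ∀ Y B → 4 * (∑[ i < B ] Y /² i) ≤ 3 * Y
  sum</² Y B = begin
    4 * (∑[ i < B ] Y /² i)              ≤⟨ *-monoʳ-≤ 4 (sum<-monoˡ-≤ (Y /²_) (m≤n+m B 3)) ⟩
    4 * (∑[ i < 3 + B ] Y /² i)          ≤⟨ *-monoʳ-≤ 4 (≤-trans (m≤m+n _ (Y / (2 + B))) (sum</²-telescope Y B)) ⟩
    4 * (Y / 4 + Y / 2)                ≡⟨ *-distribˡ-+ 4 (Y / 4) (Y / 2) ⟩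
    4 * (Y / 4) + 4 * (Y / 2)          ≡⟨ cong (4 * (Y / 4) +_) (*-assoc 2 2 (Y / 2)) ⟩
    4 * (Y / 4) + 2 * (2 * (Y / 2))    ≤⟨ +-mono-≤ (n*[Y/n]≤Y 4) (*-monoʳ-≤ 2 (n*[Y/n]≤Y 2)) ⟩
    3 * Y                              ∎
    where
    open ≤-Reasoning
    n*[Y/n]≤Y : ∀ n .{{_ : NonZero n}} → n * (Y / n) ≤ Y
    n*[Y/n]≤Y n = subst (_≤ Y) (*-comm (Y / n) n) (m/n*n≤m Y n)

  squares-sparse : ∀ {p q x y i j} → Prime p → Prime q → p ≢ q →
    q * q ∣ x + i → q * q ∣ x + j → p * p ∣ y + i → p * p ∣ y + j → i < j → i + q * q * (p * p) ≤ j
  squares-sparse {p} {q} {i = i} {j} pp pq p≢q q²∣x+i q²∣x+j p²∣y+i p²∣y+j i<j = begin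
    i + q * q * (p * p) ≤⟨ +-monoʳ-≤ i (∣⇒≤ {{>-nonZero (m<n⇒0<n∸m i<j)}} q²p²∣j∸i) ⟩
    i + (j ∸ i)         ≡⟨ m+[n∸m]≡n (<⇒≤ i<j) ⟩
    j                   ∎
    where
    open ≤-Reasoning
    q⊥p : Coprime q p
    q⊥p = primes-≢⇒coprime pq pp (p≢q ∘ sym)
    q²p²∣j∸i : q * q * (p * p) ∣ j ∸ i
    q²p²∣j∸i = coprime⇒*∣ (coprime-*ˡ (coprime-*ʳ q⊥p q⊥p) (coprime-*ʳ q⊥p q⊥p))
                 (∣-shift (<⇒≤ i<j) q²∣x+i q²∣x+j) (∣-shift (<⇒≤ i<j) p²∣y+i p²∣y+j)

  ≤∑/²+1⇒≤4B : ∀ Y B → Y ≤ ∑[ p < B ] (Y /² p + 1) → Y ≤ 4 * B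
  ≤∑/²+1⇒≤4B Y B Y≤∑ = +-cancelˡ-≤ (3 * Y) Y (4 * B) (begin
    3 * Y + Y                             ≡⟨ +-comm (3 * Y) Y ⟩
    4 * Y                                 ≤⟨ *-monoʳ-≤ 4 Y≤∑ ⟩
    4 * (∑[ p < B ] (Y /² p + 1))         ≡⟨ cong (4 *_) ∑≡ ⟩
    4 * ((∑[ p < B ] Y /² p) + B)         ≡⟨ *-distribˡ-+ 4 (∑[ p < B ] Y /² p) B ⟩
    4 * (∑[ p < B ] Y /² p) + 4 * B       ≤⟨ +-monoˡ-≤ (4 * B) (sum</² Y B) ⟩
    3 * Y + 4 * B                         ∎)
    where
    open ≤-Reasoning
    ∑≡ : ∑[ p < B ] (Y /² p + 1) ≡ (∑[ p < B ] Y /² p) + B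
    ∑≡ = trans (sum<-+ B (Y /²_) (λ _ → 1)) (cong (sum< B (Y /²_) +_) (trans (sum<-const B 1) (*-identityʳ B)))

  -- If q² ∤ d, each of the ≈ k/q² shifts j with q² ∣ m + j needs a prime p < B, p ≠ q, with p² ∣ m + d + j;
  -- one p serves only shifts q²p² apart, and Σ_p 1/p² < 3/4.
  square∣shift : ∀ {m d k q B} .{{_ : NonZero m}} → Prime q →
    (∀ {j} → j ≤ k → q * q ∣ m + j → Squareful (m + d + j)) →
    m + d + k < B * B → q * q * (4 * B + 1) ≤ suc k → q * q ∣ d
  square∣shift {m} {d} {k} {q} {B} pq shift m+d+k<B² big with q * q ∣? d
  ... | yes q²∣d = q²∣d
  ... | no  q²∤d = ⊥-elim (<⇒≱ 4B<Y (≤∑/²+1⇒≤4B Y B Y≤∑))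
    where
    instance
      q≢0 : NonZero q
      q≢0 = prime⇒nonZero pq
      q*q≢0 : NonZero (q * q)
      q*q≢0 = m*n≢0 q q

    ℓ = suc k
    Y = ℓ / (q * q)

    A? : Decidable (λ j → q * q ∣ m + j)
    A? j = q * q ∣? m + j

    Witness : ℕ → ℕ → Set
    Witness p j = Prime p × p ≢ q × q * q ∣ m + j × p * p ∣ m + d + j

    Witness? : ∀ p → Decidable (Witness p)
    Witness? p j = prime? p ×-dec ¬? (p ≟ q) ×-dec (q * q ∣? m + j) ×-dec (p * p ∣? m + d + j)

    covered : ∀ {j} → 0 ≤ j → j < ℓ → q * q ∣ m + j → Σ ℕ λ p → p < B × Witness p j
    covered {j} _ j<ℓ q²∣m+j with p , pp , p²∣m+d+j ← shift (≤-pred j<ℓ) q²∣m+j =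
      p , p<B , pp , p≢q , q²∣m+j , p²∣m+d+j
      where
      p≢q : p ≢ q
      p≢q refl = q²∤d (∣m+n∣m⇒∣n (subst (q * q ∣_) (+-right-comm m d j) p²∣m+d+j) q²∣m+j)
      p<B : p < B
      p<B = m*m<n*n⇒m<n (begin-strict
        p * p       ≤⟨ ∣⇒≤ {{m+n≢0 (m + d) j {{m+n≢0 m d}}}} p²∣m+d+j ⟩
        m + d + j   ≤⟨ +-monoʳ-≤ (m + d) (≤-pred j<ℓ) ⟩
        m + d + k   <⟨ m+d+k<B² ⟩
        B * B       ∎)
        where open ≤-Reasoning

    count-witnesses : ∀ p → count (Witness? p) 0 ℓ ≤ Y /² p + 1
    count-witnesses 0 = ≤-trans (≤-reflexive (count≡0 (Witness? 0) 0 ℓ λ _ _ w → ¬prime[0] (proj₁ w))) z≤n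
    count-witnesses 1 = ≤-trans (≤-reflexive (count≡0 (Witness? 1) 0 ℓ λ _ _ w → ¬prime[1] (proj₁ w))) z≤n
    count-witnesses p@(suc (suc _)) =
      subst (λ c → count (Witness? p) 0 ℓ ≤ c + 1) (sym (m/n/o≡m/[n*o] ℓ (q * q) (p * p)))
        (count-sparse (Witness? p) (q * q * (p * p)) sparse 0 ℓ)
      where
      instance
        q²p²≢0 : NonZero (q * q * (p * p))
        q²p²≢0 = m*n≢0 (q * q) (p * p)
      sparse : ∀ {i j} → Witness p i → Witness p j → i < j → i + q * q * (p * p) ≤ j
      sparse (pp , p≢q , q²∣i , p²∣i) (_ , _ , q²∣j , p²∣j) = squares-sparse pp pq p≢q q²∣i q²∣j p²∣i p²∣j

    Y≤∑ : Y ≤ ∑[ p < B ] (Y /² p + 1)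
    Y≤∑ = begin
      Y                                   ≤⟨ count-multiples (q * q) m 0 Y ⟩
      count A? 0 (Y * (q * q))            ≤⟨ count-monoʳ-≤ A? 0 (m/n*n≤m ℓ (q * q)) ⟩
      count A? 0 ℓ                        ≤⟨ count-union A? Witness? B 0 ℓ covered ⟩
      ∑[ p < B ] count (Witness? p) 0 ℓ   ≤⟨ sum<-mono-≤ B (λ p _ → count-witnesses p) ⟩
      ∑[ p < B ] (Y /² p + 1)             ∎
      where open ≤-Reasoning

    4B<Y : 4 * B < Y
    4B<Y = subst (_≤ Y) (+-comm (4 * B) 1) (m*n≤o⇒m≤o/n (4 * B + 1) (q * q) ℓ (subst (_≤ ℓ) (*-comm (q * q) _) big))

  -- Primes up to Q

  primesUpTo : ℕ → List ℕ
  primesUpTo Q = filter prime? (downFrom (suc Q))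

  π : ℕ → ℕ
  π Q = length (primesUpTo Q)

  primesUpTo-prime : ∀ Q → All Prime (primesUpTo Q)
  primesUpTo-prime Q = all-filter prime? (downFrom (suc Q))

  ∈-primesUpTo⁺ : ∀ {p Q} → Prime p → p ≤ Q → p ∈ primesUpTo Q
  ∈-primesUpTo⁺ pp p≤Q = ∈-filter⁺ prime? (∈-downFrom⁺ (s≤s p≤Q)) pp

  ∈-primesUpTo⁻ : ∀ {p Q} → p ∈ primesUpTo Q → p ≤ Q
  ∈-primesUpTo⁻ {Q = Q} p∈ = ≤-pred (∈-downFrom⁻ (proj₁ (∈-filter⁻ prime? {xs = downFrom (suc Q)} p∈)))

  π≤ : ∀ Q → π Q ≤ Q
  π≤ zero    = z≤n
  π≤ (suc Q) with prime? (suc Q)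
  ... | yes pQ = s≤s (π≤ Q)
  ... | no ¬pQ = m≤n⇒m≤1+n (π≤ Q)

  π!≤primorial : ∀ Q → π Q ! ≤ product (primesUpTo Q)
  π!≤primorial zero    = ≤-refl
  π!≤primorial (suc Q) with prime? (suc Q)
  ... | yes pQ = *-mono-≤ (s≤s (π≤ Q)) (π!≤primorial Q)
  ... | no ¬pQ = π!≤primorial Q

  primorial∣ : ∀ Q {d} → (∀ {p} → Prime p → p ≤ Q → p ∣ d) → product (primesUpTo Q) ∣ d
  primorial∣ zero    _     = 1∣ _
  primorial∣ (suc Q) p∣d with prime? (suc Q)
  ... | yes pQ =
    coprime⇒*∣ (prime∤⇒coprime pQ Q+1∤primorial) (p∣d pQ ≤-refl) (primorial∣ Q λ pp p≤Q → p∣d pp (m≤n⇒m≤1+n p≤Q))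
    where
    Q+1∤primorial : ¬ suc Q ∣ product (primesUpTo Q)
    Q+1∤primorial Q+1∣ = 1+n≰n (∈-primesUpTo⁻ (factorisationHasAllPrimeFactors pQ Q+1∣ (primesUpTo-prime Q)))
  ... | no ¬pQ =
    primorial∣ Q λ pp p≤Q → p∣d pp (m≤n⇒m≤1+n p≤Q)

  subsetProducts : List ℕ → List ℕ
  subsetProducts []       = 1 ∷ []
  subsetProducts (p ∷ ps) = subsetProducts ps ++ map (p *_) (subsetProducts ps)

  length-subsetProducts : ∀ ps → length (subsetProducts ps) ≡ 2 ^ length ps
  length-subsetProducts []       = refl
  length-subsetProducts (p ∷ ps) = begin
    length (sps ++ map (p *_) sps)        ≡⟨ length-++ sps ⟩
    length sps + length (map (p *_) sps)  ≡⟨ cong (length sps +_) (length-map (p *_) sps) ⟩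
    length sps + length sps               ≡⟨ cong (length sps +_) (+-identityʳ (length sps)) ⟨
    2 * length sps                        ≡⟨ cong (2 *_) (length-subsetProducts ps) ⟩
    2 ^ length (p ∷ ps)                   ∎
    where
    open ≡-Reasoning
    sps = subsetProducts ps

  SquareTimesSubsetProduct : List ℕ → ℕ → Set
  SquareTimesSubsetProduct ps x = Σ ℕ λ r → Σ ℕ λ f → f ∈ subsetProducts ps × x ≡ r * r * f

  module _ {p : ℕ} {ps : List ℕ} where

    squareTimes-*p² : ∀ {y} → SquareTimesSubsetProduct ps y → SquareTimesSubsetProduct ps (y * (p * p))
    squareTimes-*p² (r , f , f∈ , refl) = p * r , f , f∈ , shuffle r f p
      where
      shuffle : ∀ r f p → r * r * f * (p * p) ≡ p * r * (p * r) * f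
      shuffle = solve-∀

    squareTimes-*p : ∀ {y} → SquareTimesSubsetProduct ps y → SquareTimesSubsetProduct (p ∷ ps) (y * p)
    squareTimes-*p (r , f , f∈ , refl) = r , p * f , ∈-++⁺ʳ _ (∈-map⁺ (p *_) f∈) , shuffle r f p
      where
      shuffle : ∀ r f p → r * r * f * p ≡ r * r * (p * f)
      shuffle = solve-∀

    squareTimes-∷ : ∀ {x} → SquareTimesSubsetProduct ps x → SquareTimesSubsetProduct (p ∷ ps) x
    squareTimes-∷ (r , f , f∈ , eq) = r , f , ∈-++⁺ˡ f∈ , eq

  squareTimesSubsetProduct : ∀ {ps} → All Prime ps → ∀ x → .{{NonZero x}} →
    (∀ {q} → Prime q → q ∣ x → q ∈ ps) → SquareTimesSubsetProduct ps x
  squareTimesSubsetProduct [] 1 _ = 1 , 1 , here refl , refl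
  squareTimesSubsetProduct [] (suc (suc x)) factors∈ with q , pq , q∣x ← ∃prime∣ {suc (suc x)} (s≤s (s≤s z≤n))
    with () ← factors∈ pq q∣x
  squareTimesSubsetProduct {p ∷ ps} (pp ∷ aps) x₀ factors∈₀ = go x₀ (<-wellFounded x₀) factors∈₀
    where
    instance
      p≢0 : NonZero p
      p≢0 = prime⇒nonZero pp

    go : ∀ x → .{{NonZero x}} → Acc _<_ x → (∀ {q} → Prime q → q ∣ x → q ∈ p ∷ ps) →
      SquareTimesSubsetProduct (p ∷ ps) x
    go x (acc rec) factors∈ with p * p ∣? x | p ∣? x
    ... | yes (divides y refl) | _ =
      squareTimes-*p² {p} {p ∷ ps} (go y {{m*n≢0⇒m≢0 y}} (rec (m<m*n y (p * p) {{m*n≢0⇒m≢0 y}} p*p>1))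
        λ pq q∣y → factors∈ pq (∣-trans q∣y (m∣m*n (p * p))))
      where
      p*p>1 : 1 < p * p
      p*p>1 = <-≤-trans (prime>1 pp) (m≤m*n p p)
    ... | no p²∤x | yes (divides y refl) =
      squareTimes-*p {p} {ps} (squareTimesSubsetProduct aps y {{m*n≢0⇒m≢0 y}} factors∈y)
      where
      factors∈y : ∀ {q} → Prime q → q ∣ y → q ∈ ps
      factors∈y pq q∣y with factors∈ pq (∣-trans q∣y (m∣m*n p))
      ... | here refl = ⊥-elim (p²∤x (*-monoˡ-∣ p q∣y))
      ... | there q∈ = q∈
    ... | no _ | no p∤x = squareTimes-∷ {p} {ps} (squareTimesSubsetProduct aps x factors∈x)
      where
      factors∈x : ∀ {q} → Prime q → q ∣ x → q ∈ ps
      factors∈x pq q∣x with factors∈ pq q∣x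
      ... | here refl = ⊥-elim (p∤x q∣x)
      ... | there q∈ = q∈

  length-cartesianProductWith : ∀ {A B C : Set} (f : A → B → C) xs ys →
    length (cartesianProductWith f xs ys) ≡ length xs * length ys
  length-cartesianProductWith f []       ys = refl
  length-cartesianProductWith f (x ∷ xs) ys =
    trans (length-++ (map (f x) ys)) (cong₂ _+_ (length-map (f x) ys) (length-cartesianProductWith f xs ys))

  covers⇒≤length : ∀ Q {ys} → (∀ {x} → 1 ≤ x → x ≤ Q → x ∈ ys) → Q ≤ length ys
  covers⇒≤length zero    _      = z≤n
  covers⇒≤length (suc Q) {ys} covers = begin-strict
    Q                          ≤⟨ covers⇒≤length Q covers′ ⟩
    length (filter ≢Q+1? ys)   <⟨ filter-notAll ≢Q+1? ys (Any.map (λ { refl ≢ → ≢ refl }) (covers (s≤s z≤n) ≤-refl)) ⟩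
    length ys                  ∎
    where
    open ≤-Reasoning
    ≢Q+1? : Decidable (_≢ suc Q)
    ≢Q+1? x = ¬? (x ≟ suc Q)
    covers′ : ∀ {x} → 1 ≤ x → x ≤ Q → x ∈ filter ≢Q+1? ys
    covers′ 1≤x x≤Q = ∈-filter⁺ ≢Q+1? (covers 1≤x (m≤n⇒m≤1+n x≤Q)) (<⇒≢ (s≤s x≤Q))

  -- Erdős: every 1 ≤ x ≤ Q is r² f with r ≤ √Q and f a product of distinct primes ≤ Q, so Q ≤ √Q · 2^π(Q).
  ≤4^π : ∀ Q → Q ≤ 4 ^ π Q
  ≤4^π zero        = z≤n
  ≤4^π Q@(suc Q-1) with R , R²≤Q , Q<[R+1]² ← sqrt-bracket 1 Q = *-cancelˡ-≤ Q (begin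
    Q * Q                         ≤⟨ *-mono-≤ Q≤R*2^π Q≤R*2^π ⟩
    R * 2 ^ π Q * (R * 2 ^ π Q)   ≡⟨ shuffle R (2 ^ π Q) ⟩
    R * R * 1 * (2 ^ π Q * 2 ^ π Q) ≤⟨ *-mono-≤ R²≤Q (≤-reflexive (sym (^-distribʳ-* 2 2 (π Q)))) ⟩
    Q * 4 ^ π Q                   ∎)
    where
    open ≤-Reasoning
    shuffle : ∀ a b → a * b * (a * b) ≡ a * a * 1 * (b * b)
    shuffle = solve-∀
    ps = primesUpTo Q
    candidates = cartesianProductWith (λ r f → r * r * f) (map suc (upTo R)) (subsetProducts ps)
    covered : ∀ {x} → 1 ≤ x → x ≤ Q → x ∈ candidates
    covered {x} 1≤x x≤Q with squareTimesSubsetProduct (primesUpTo-prime Q) x {{>-nonZero 1≤x}}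
                               (λ pq q∣x → ∈-primesUpTo⁺ pq (≤-trans (∣⇒≤ {{>-nonZero 1≤x}} q∣x) x≤Q))
    ... | zero , _ , _ , refl with () ← 1≤x
    ... | r@(suc r-1) , f , f∈ , refl =
      ∈-cartesianProductWith⁺ (λ r f → r * r * f) (∈-map⁺ suc (∈-upTo⁺ r≤R)) f∈
      where
      r≤R : r-1 < R
      r≤R = ≤-pred (m*m<n*n⇒m<n (begin-strict
        r * r               ≤⟨ m≤m*n (r * r) f {{m*n≢0⇒n≢0 (r * r) {{>-nonZero 1≤x}}}} ⟩
        r * r * f           ≤⟨ x≤Q ⟩
        Q                   <⟨ Q<[R+1]² ⟩
        suc R * suc R * 1   ≡⟨ *-identityʳ (suc R * suc R) ⟩
        suc R * suc R       ∎))
    Q≤R*2^π : Q ≤ R * 2 ^ π Q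
    Q≤R*2^π = ≤-trans (covers⇒≤length Q covered) (≤-reflexive (begin-equality
      length candidates                                        ≡⟨ length-cartesianProductWith _ (map suc (upTo R)) _ ⟩
      length (map suc (upTo R)) * length (subsetProducts ps)   ≡⟨ cong₂ _*_ (trans (length-map suc (upTo R)) (length-upTo R))
                                                                            (length-subsetProducts ps) ⟩
      R * 2 ^ π Q                                              ∎))

  suc≤2*4^π : ∀ Q → suc Q ≤ 2 * 4 ^ π Q
  suc≤2*4^π Q = begin
    suc Q                 ≡⟨ +-comm 1 Q ⟩
    Q + 1                 ≤⟨ +-mono-≤ (≤4^π Q) (m^n>0 4 (π Q)) ⟩
    4 ^ π Q + 4 ^ π Q     ≡⟨ cong (4 ^ π Q +_) (+-identityʳ (4 ^ π Q)) ⟨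
    2 * 4 ^ π Q           ∎
    where open ≤-Reasoning

  -- Rigidity of t on long windows

  power-gap⇒≤^ : ∀ {a b k n W} .{{_ : NonZero n}} → suc b ≤ 2 * a → n ^ a ≤ k ^ b → k * k ≤ W * n → n ≤ W ^ b
  power-gap⇒≤^ {a} {b} {k} {n} {W} b<2a nᵃ≤kᵇ k²≤Wn = *-cancelʳ-≤ n (W ^ b) (n ^ b) {{m^n≢0 n b}} (begin
    n * n ^ b        ≤⟨ ^-monoʳ-≤ n b<2a ⟩
    n ^ (a + (a + 0)) ≡⟨ cong (λ e → n ^ (a + e)) (+-identityʳ a) ⟩
    n ^ (a + a)      ≡⟨ ^-distribˡ-+-* n a a ⟩
    n ^ a * n ^ a    ≤⟨ *-mono-≤ nᵃ≤kᵇ nᵃ≤kᵇ ⟩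
    k ^ b * k ^ b    ≡⟨ ^-distribʳ-* k k b ⟨
    (k * k) ^ b      ≤⟨ ^-monoˡ-≤ b k²≤Wn ⟩
    (W * n) ^ b      ≡⟨ ^-distribʳ-* W n b ⟩
    W ^ b * n ^ b    ∎)
    where open ≤-Reasoning

  [4B+1]²≤137n : ∀ R n → R * R * 1 ≤ 2 * n → 1 ≤ n → (4 * suc R + 1) * (4 * suc R + 1) ≤ 137 * n
  [4B+1]²≤137n R n R²≤2n 1≤n = begin
    (4 * suc R + 1) * (4 * suc R + 1)    ≡⟨ expand R ⟩
    16 * (R * R * 1) + 40 * R + 25       ≤⟨ +-mono-≤ (+-mono-≤ (*-monoʳ-≤ 16 R²≤2n) (*-monoʳ-≤ 40 R≤2n))
                                                    (*-monoʳ-≤ 25 1≤n) ⟩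
    16 * (2 * n) + 40 * (2 * n) + 25 * n ≡⟨ collect n ⟩
    137 * n                              ∎
    where
    open ≤-Reasoning
    expand : ∀ R → (4 * suc R + 1) * (4 * suc R + 1) ≡ 16 * (R * R * 1) + 40 * R + 25
    expand = solve-∀
    collect : ∀ n → 16 * (2 * n) + 40 * (2 * n) + 25 * n ≡ 137 * n
    collect = solve-∀
    R≤2n : R ≤ 2 * n
    R≤2n = ≤-trans (n≤n*n R) (≤-trans (≤-reflexive (sym (*-identityʳ (R * R)))) R²≤2n)

  k²≤x⁴*137n : ∀ {k x c n} → suc k < x * x * c → c * c ≤ 137 * n → k * k ≤ x * x * (x * x) * 137 * n
  k²≤x⁴*137n {k} {x} {c} {n} k+1<x²c c²≤137n = begin
    k * k                          ≤⟨ *-mono-≤ k≤x²c k≤x²c ⟩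
    x * x * c * (x * x * c)        ≡⟨ shuffle x c ⟩
    x * x * (x * x) * (c * c)      ≤⟨ *-monoʳ-≤ (x * x * (x * x)) c²≤137n ⟩
    x * x * (x * x) * (137 * n)    ≡⟨ *-assoc (x * x * (x * x)) 137 n ⟨
    x * x * (x * x) * 137 * n      ∎
    where
    open ≤-Reasoning
    k≤x²c : k ≤ x * x * c
    k≤x²c = <⇒≤ (<-trans (n<1+n k) k+1<x²c)
    shuffle : ∀ x c → x * x * c * (x * x * c) ≡ x * x * (x * x) * (c * c)
    shuffle = solve-∀

  X⁴*137≤ : ∀ {X} s → X ≤ 2 * 4 ^ s → X * X * (X * X) * 137 ≤ 2192 * 256 ^ s
  X⁴*137≤ {X} s X≤ = begin
    X * X * (X * X) * 137            ≤⟨ *-monoˡ-≤ 137 (*-mono-≤ (*-mono-≤ X≤ X≤) (*-mono-≤ X≤ X≤)) ⟩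
    Y * Y * (Y * Y) * 137            ≡⟨ collect (4 ^ s) ⟩
    2192 * (4 ^ s * 4 ^ s * (4 ^ s * 4 ^ s)) ≡⟨ cong (2192 *_) (cong₂ _*_ (^-distribʳ-* 4 4 s) (^-distribʳ-* 4 4 s)) ⟨
    2192 * (16 ^ s * 16 ^ s)         ≡⟨ cong (2192 *_) (^-distribʳ-* 16 16 s) ⟨
    2192 * 256 ^ s                   ∎
    where
    open ≤-Reasoning
    Y = 2 * 4 ^ s
    collect : ∀ y → 2 * y * (2 * y) * (2 * y * (2 * y)) * 137 ≡ 2192 * (y * y * (y * y))
    collect = solve-∀

  t-window-shift⇒π-bounds : ∀ {a b k m d} .{{_ : NonZero m}} .{{_ : NonZero d}} → suc b ≤ 2 * a →
    (m + d) ^ a ≤ k ^ b → k ≤ m → (∀ {j} → j ≤ k → t (m + j) ≡ t (m + d + j)) →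
    Σ ℕ λ s → s ! ≤ m + d × m + d ≤ 2192 ^ b * (256 ^ b) ^ s
  t-window-shift⇒π-bounds {a} {b} {k} {m} {d} b<2a nᵃ≤kᵇ k≤m same-t
    with R , R²≤2n , 2n<[R+1]² ← sqrt-bracket 1 (2 * (m + d))
    with Q , Q²c≤k+1 , k+1<[Q+1]²c ← sqrt-bracket (4 * suc R + 1) (suc k)
    = π Q , π!≤n , n≤bound
    where
    open ≤-Reasoning
    n = m + d
    B = suc R
    c = 4 * B + 1
    X = suc Q

    instance
      n≢0 : NonZero n
      n≢0 = m+n≢0 m d

    n+k<B² : n + k < B * B
    n+k<B² = begin-strict
      n + k       ≤⟨ +-monoʳ-≤ n (≤-trans k≤m (m≤m+n m d)) ⟩
      n + n       ≡⟨ cong (n +_) (+-identityʳ n) ⟨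
      2 * n       <⟨ 2n<[R+1]² ⟩
      B * B * 1   ≡⟨ *-identityʳ (B * B) ⟩
      B * B       ∎

    q²∣d : ∀ {q} → Prime q → q ≤ Q → q * q ∣ d
    q²∣d pq q≤Q = square∣shift pq
      (λ j≤k q²∣m+j → squareful-resp-t {{m+n≢0 m _}} (same-t j≤k) (_ , pq , q²∣m+j))
      n+k<B² (≤-trans (*-monoˡ-≤ c (*-mono-≤ q≤Q q≤Q)) Q²c≤k+1)

    π!≤n : π Q ! ≤ n
    π!≤n = begin
      π Q !                    ≤⟨ π!≤primorial Q ⟩
      product (primesUpTo Q)   ≤⟨ ∣⇒≤ (primorial∣ Q λ pq q≤Q → ∣-trans (m∣m*n _) (q²∣d pq q≤Q)) ⟩
      d                        ≤⟨ m≤n+m d m ⟩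
      n                        ∎

    k²≤X⁴*137*n : k * k ≤ X * X * (X * X) * 137 * n
    k²≤X⁴*137*n = k²≤x⁴*137n {k} {X} {c} {n} k+1<[Q+1]²c ([4B+1]²≤137n R n R²≤2n (>-nonZero⁻¹ n))

    n≤bound : n ≤ 2192 ^ b * (256 ^ b) ^ π Q
    n≤bound = begin
      n                               ≤⟨ power-gap⇒≤^ {a} b<2a nᵃ≤kᵇ k²≤X⁴*137*n ⟩
      (X * X * (X * X) * 137) ^ b     ≤⟨ ^-monoˡ-≤ b (X⁴*137≤ (π Q) (suc≤2*4^π Q)) ⟩
      (2192 * 256 ^ π Q) ^ b          ≡⟨ ^-swap 2192 256 (π Q) b ⟩
      2192 ^ b * (256 ^ b) ^ π Q      ∎

  t-window-rigidity : ∀ a b .{{_ : NonZero b}} → suc b ≤ 2 * a → Σ ℕ λ K →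
    ∀ {k m n} → K ≤ k → .{{NonZero m}} → m ≤ n → n ^ a ≤ k ^ b → k ≤ m →
    (∀ {j} → j ≤ k → t (m + j) ≡ t (n + j)) → n ≡ m
  t-window-rigidity a b b<2a = suc (C * G ^ S) , no-shift
    where
    C = 2192 ^ b
    G = 256 ^ b

    instance
      G≢0 : NonZero G
      G≢0 = m^n≢0 256 b

    threshold : Σ ℕ λ S → ∀ s → S ≤ s → C * G ^ s < s !
    threshold = exp<!-eventually C G (≤-trans (s≤s (s≤s z≤n)) (^-monoʳ-≤ 256 (>-nonZero⁻¹ b)))

    S = proj₁ threshold

    beyond-threshold : ∀ {n} → C * G ^ S < n → ¬ (Σ ℕ λ s → s ! ≤ n × n ≤ C * G ^ s)
    beyond-threshold C*Gˢ<n (s , s!≤n , n≤C*Gˢ) with S ≤? s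
    ... | yes S≤s = <⇒≱ (proj₂ threshold s S≤s) (≤-trans s!≤n n≤C*Gˢ)
    ... | no  S≰s = <⇒≱ C*Gˢ<n (≤-trans n≤C*Gˢ (*-monoʳ-≤ C (^-monoʳ-≤ G (<⇒≤ (≰⇒> S≰s)))))

    no-shift : ∀ {k m n} → suc (C * G ^ S) ≤ k → .{{NonZero m}} → m ≤ n → n ^ a ≤ k ^ b → k ≤ m →
      (∀ {j} → j ≤ k → t (m + j) ≡ t (n + j)) → n ≡ m
    no-shift {k} {m} K≤k m≤n nᵃ≤kᵇ k≤m same-t with m≤n⇒∃[o]m+o≡n m≤n
    ... | zero  , refl = +-identityʳ m
    -- the implicit arguments are given because inferring d would make Agda normalise t (m + d + j)
    ... | suc d , refl = ⊥-elim (beyond-threshold (≤-trans K≤k (≤-trans k≤m m≤n))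
                            (t-window-shift⇒π-bounds {a} {b} {k} {m} {suc d} b<2a nᵃ≤kᵇ k≤m same-t))


open import Defs
open import Data.Nat as ℕ using (ℕ; suc; z≤n; _+_; _∸_; _≤_; NonZero)
import Data.Nat.Properties as ℕₚ
open import Data.Integer using (+_; -[1+_]; ∣_∣)
open import Data.Integer.Properties using (+◃-cancel-<)
open import Data.Rational as ℚ using (ℚ; mkℚ; ↥_; ↧ₙ_; ½; 1ℚ; 0ℚ; _/_; _-_)
import Data.Rational.Properties as ℚₚ
open import Data.Product using (Σ; _,_)
open import Relation.Binary.PropositionalEquality using (_≡_; sym; subst; subst₂)
open ShiftRigidity using (t-window-rigidity)

½<⇒↧<2↥ : ∀ r → ½ ℚ.< r → suc (↧ₙ r) ≤ 2 ℕ.* ∣ ↥ r ∣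
½<⇒↧<2↥ (mkℚ (+ a) den _) (ℚ.*<* h) = subst₂ ℕ._<_ (ℕₚ.*-identityˡ (suc den)) (ℕₚ.*-comm a 2) (+◃-cancel-< h)
½<⇒↧<2↥ (mkℚ -[1+ _ ] _ _) (ℚ.*<* ())

↧ₙ≢0 : ∀ r → NonZero (↧ₙ r)
↧ₙ≢0 (mkℚ _ _ _) = _

≤^[1]⇒≤ : ∀ {k m} → k ≤ m ^[ 1ℚ ] → k ≤ m
≤^[1]⇒≤ {k} {m} = subst₂ _≤_ (ℕₚ.*-identityʳ k) (ℕₚ.*-identityʳ m)

m∸m≤0·m^[r] : ∀ m r → (m ∸ m) ≤ 0 · m ^[ r ]
m∸m≤0·m^[r] m (mkℚ _ _ _) rewrite ℕₚ.n∸n≡0 m = z≤n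

theorem10 : (α β : ℝ) → L α ½ → α <ℝ β → U β 1ℚ →
  Σ ℕ λ K → Σ ℕ λ C →
  ∀ k m n → K ≤ k → 1 ≤ m → m ≤ n →
  (∀ r → 0ℚ ℚ.≤ r → L α r → n ^[ r ]≤ k) →
  (∀ r → U β r → k ≤ m ^[ r ]) →
  (∀ j → j ≤ k → t (m + j) ≡ t (n + j)) →
  ∀ r → L α ((+ 3 / 2) - r) → (n ∸ m) ≤ C · m ^[ r ]
theorem10 α β ½<α _ β<1 with r₀ , ½<r₀ , r₀<α ← L-rounded₁ α ½ ½<α
  with K , rigid ← t-window-rigidity ∣ ↥ r₀ ∣ (↧ₙ r₀) {{↧ₙ≢0 r₀}} (½<⇒↧<2↥ r₀ ½<r₀) =
  K , 0 , λ k m n K≤k 1≤m m≤n nʳ≤k k≤mʳ same-t r _ →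
    let n≡m = rigid K≤k {{ℕ.>-nonZero 1≤m}} m≤n (nʳ≤k r₀ 0≤r₀ r₀<α) (≤^[1]⇒≤ (k≤mʳ 1ℚ β<1)) (λ {j} → same-t j)
    in subst (λ x → (x ∸ m) ≤ 0 · m ^[ r ]) (sym n≡m) (m∸m≤0·m^[r] m r)
  where
  0≤r₀ : 0ℚ ℚ.≤ r₀
  0≤r₀ = ℚₚ.<⇒≤ (ℚₚ.<-trans (ℚₚ.positive⁻¹ ½) ½<r₀)
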